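{- For every $m\ge 1$, $\mathrm{Ind}(G_m)$ is vertex decomposable.
   Context: $\mathrm{Ind}(G)$ is the independence complex of $G$ (faces are independent sets). The graphs $G_m$: $G_1$ has vertices $a_1,b_1$ and edge $a_1b_1$; for $m\ge1$, $G_{m+1}$ is obtained from $G_m$ by adding vertices $a_{m+1},b_{m+1},c_{m+1}$ and edges $a_ma_{m+1}$, $b_mc_{m+1}$, $a_{m+1}b_{m+1}$, $b_{m+1}c_{m+1}$, and, when $m\ge2$, also $c_ma_{m+1}$. A pure simplicial complex $\Delta$ is vertex decomposable if it is a simplex (including $\emptyset$) or there is a vertex $v$ such that the link $\mathrm{lk}_\Delta(v)=\{\tau\in\Delta: v\notin\tau,\tau\cup\{v\}\in\Delta\}$ and the deletion $\{\tau\in\Delta:v\notin\tau\}$ are both vertex decomposable. -}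

module Defs where

open import Data.Nat using (ℕ; zero; suc; _+_; _*_; _∸_)
open import Data.Fin using (Fin; toℕ)
open import Data.Fin.Subset using (Subset; _∈_; _∉_; _⊆_; ∣_∣; ⁅_⁆; _∪_)
open import Data.List using (List; []; _∷_; _++_)
import Data.List.Membership.Propositional as L
open import Data.Product using (Σ; _×_; _,_)
open import Data.Sum using (_⊎_)
open import Relation.Nullary using (¬_)
open import Relation.Binary.PropositionalEquality using (_≡_)

Complex : ℕ → Set₁
Complex n = Subset n → Set

module _ {n : ℕ} where

  Facet : Complex n → Subset n → Set
  Facet Δ σ = Δ σ × (∀ τ → Δ τ → σ ⊆ τ → τ ≡ σ)

  Pure : Complex n → Set
  Pure Δ = ∀ σ τ → Facet Δ σ → Facet Δ τ → ∣ σ ∣ ≡ ∣ τ ∣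

  IsSimplex : Complex n → Set
  IsSimplex Δ = Σ (Subset n) λ σ → Δ σ × (∀ τ → (Δ τ → τ ⊆ σ) × (τ ⊆ σ → Δ τ))

  link : Complex n → Fin n → Complex n
  link Δ v τ = (v ∉ τ) × Δ (τ ∪ ⁅ v ⁆)

  deletion : Complex n → Fin n → Complex n
  deletion Δ v τ = (v ∉ τ) × Δ τ

  data VertexDecomposable (Δ : Complex n) : Set₁ where
    simplex : Pure Δ → IsSimplex Δ → VertexDecomposable Δ
    shed    : Pure Δ → (v : Fin n) → Δ ⁅ v ⁆ →
              VertexDecomposable (link Δ v) →
              VertexDecomposable (deletion Δ v) →
              VertexDecomposable Δ

  Ind : (Fin n → Fin n → Set) → Complex n
  Ind E σ = ∀ u v → u ∈ σ → v ∈ σ → ¬ E u v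

-- The graphs G_m.  Vertex labels (natural numbers, 1-based index i):
--   a_1 = 0, b_1 = 1, and for i ≥ 2: a_i = 3i-4, b_i = 3i-3, c_i = 3i-2.
-- G_m has 3m-1 vertices, labelled 0 .. 3m-2.

a b c : ℕ → ℕ
a 1 = 0
a i = 3 * i ∸ 4
b 1 = 1
b i = 3 * i ∸ 3
c i = 3 * i ∸ 2

-- edges added when passing from G_m to G_{m+1}  (m ≥ 1)
newEdges : ℕ → List (ℕ × ℕ)
newEdges m = (a m , a (suc m)) ∷ (b m , c (suc m)) ∷ (a (suc m) , b (suc m))
           ∷ (b (suc m) , c (suc m)) ∷ []

extraEdge : ℕ → List (ℕ × ℕ)
extraEdge 0 = []
extraEdge 1 = []
extraEdge m = (c m , a (suc m)) ∷ []

-- edgesG k = edge list of G_{k+1}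
edgesG : ℕ → List (ℕ × ℕ)
edgesG zero    = (a 1 , b 1) ∷ []
edgesG (suc k) = edgesG k ++ newEdges (suc k) ++ extraEdge (suc k)

-- number of vertices of G_{k+1}: 3(k+1) - 1 = 3k + 2
nG : ℕ → ℕ
nG k = 2 + 3 * k

AdjG : (k : ℕ) → Fin (nG k) → Fin (nG k) → Set
AdjG k u v = ((toℕ u , toℕ v) L.∈ edgesG k) ⊎ ((toℕ v , toℕ u) L.∈ edgesG k)

module Submission where

-- Shedding a vertex v of an induced subgraph H of G_m splits Ind(H) into the link
-- Ind(H ∖ N[v]) and the deletion Ind(H ∖ v); if v is isolated in H, Ind(H) is a cone over
-- Ind(H ∖ v). Writing H + x when x is an isolated vertex of H + x, the following induced
-- subgraphs are closed under shedding (with analogous, simpler cases at level 1):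
--
--   H                      facets  shed at  link                  deletion
--   G_{n+2}                n + 2   a_{n+2}  G_{n+2} ∖ N[a_{n+2}]  G_{n+2} ∖ a_{n+2}
--   G_{n+2} ∖ N[a_{n+2}]   n + 1   b_{n+1}  G_n                   G_n + c_{n+2}
--   G_{n+2} ∖ a_{n+2}      n + 2   c_{n+2}  G_{n+1} ∖ b_{n+1}     G_{n+1} + b_{n+2}
--   G_{n+2} ∖ b_{n+2}      n + 2   b_{n+1}  G_n + a_{n+2}         Y_n + c_{n+2}
--   Y_n                    n + 1   a_{n+2}  G_n                   G_{n+1} ∖ b_{n+1}
--
-- where Y_n = (G_{n+1} ∖ b_{n+1}) + a_{n+2}. A simultaneous induction on n along this table
-- shows that each Ind(H) is vertex decomposable with all facets of the listed size; the sizes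
-- are what make every complex of the decomposition pure. Induced subgraphs are given by Boolean
-- predicates on the vertex labels, so that each entry of the table is checked by computation.

open import Defs
open import Data.Bool using (Bool; true; false; T; not; _∧_; _∨_) renaming (_≟_ to _≟ᵇ_)
open import Data.Bool.Properties using (T-∨)
open import Data.Empty using (⊥-elim)
open import Data.Fin using (Fin; suc; toℕ; fromℕ<) renaming (_≟_ to _≟ᶠ_)
open import Data.Fin.Properties using (toℕ<n; toℕ-fromℕ<; toℕ-injective; all?; any?)
open import Data.Fin.Subset using (Subset; inside; outside; _∈_; _∉_; _⊆_; ∣_∣; ⁅_⁆; _∪_; _-_; ⊥)
open import Data.Fin.Subset.Properties
  using ( _∈?_; p─⊥≡p; p─q⊆p; x∈p∧x≢y⇒x∈p-y; x∈p∪q⁺; x∈p∪q⁻; p⊆p∪q; x∈⁅x⁆; x∈⁅y⁆⇒x≡y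
        ; ⊆-antisym; ∉⊥; ⊥⊆; ∣⊥∣≡0)
open import Data.List using (_∷_; _++_)
open import Data.List.Membership.Propositional using () renaming (_∈_ to _∈ᴸ_)
open import Data.List.Membership.Propositional.Properties using (∈-++⁺ˡ; ∈-++⁺ʳ; ∈-++⁻)
open import Data.List.Relation.Unary.Any using (here; there)
open import Data.Nat
  using (ℕ; zero; suc; _+_; _*_; _∸_; _≤_; _<_; _≟_; _≤′_; ≤′-refl; ≤′-step; z≤n; s≤s; _<ᵇ_; _≡ᵇ_)
open import Data.Nat.Properties
  using ( *-comm; ≤-refl; ≤-trans; ≤-<-trans; m≤n⇒m≤1+n; n≤1+n; n<1+n; *-monoˡ-≤; +-monoʳ-≤
        ; *-cancelʳ-<; ≤-pred; <⇒≤; ≤⇒≤′; _<?_; ≮⇒≥; m≤n⇒∃[o]m+o≡n; ≡ᵇ⇒≡; ≡⇒≡ᵇ; <⇒<ᵇ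
        ; module ≤-Reasoning)
open import Data.Product using (_×_; _,_; proj₁; proj₂; map₁; map₂)
open import Data.Sum using (_⊎_; inj₁; inj₂; swap; [_,_]) renaming (map to ⊎-map)
open import Data.Vec.Base using (_∷_; here; there)
open import Function using (_∘_; id)
open import Function.Bundles using (Equivalence; _⇔_; mk⇔)
open import Level using (0ℓ)
open import Relation.Binary.PropositionalEquality
  using (_≡_; _≢_; refl; sym; trans; cong; cong₂; subst; subst₂; _≗_)
open import Relation.Nullary using (¬_; yes; no)
open import Relation.Nullary.Decidable using (True; toWitness; T?; _×-dec_)
open import Relation.Unary using (Pred; _≐_; _∩_; ∁; ｛_｝; Empty; Universal)
open import Relation.Unary.Properties using (≐-sym; ≐-trans)

x∉p-x : ∀ {n} (p : Subset n) x → x ∉ p - x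
x∉p-x (_ ∷ p) (suc x) (there x∈p-x) = x∉p-x p x x∈p-x

∣p∣≡1+∣p-x∣ : ∀ {n} {p : Subset n} {x} → x ∈ p → ∣ p ∣ ≡ suc ∣ p - x ∣
∣p∣≡1+∣p-x∣ {p = _ ∷ p}       here        = cong (suc ∘ ∣_∣) (sym (p─⊥≡p p))
∣p∣≡1+∣p-x∣ {p = inside ∷ p}  (there x∈p) = cong suc (∣p∣≡1+∣p-x∣ x∈p)
∣p∣≡1+∣p-x∣ {p = outside ∷ p} (there x∈p) = ∣p∣≡1+∣p-x∣ x∈p

p-x∪⁅x⁆≡p : ∀ {n} {p : Subset n} {x} → x ∈ p → (p - x) ∪ ⁅ x ⁆ ≡ p
p-x∪⁅x⁆≡p {p = p} {x} x∈p = ⊆-antisym ⊆p p⊆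
  where
  ⊆p : (p - x) ∪ ⁅ x ⁆ ⊆ p
  ⊆p y∈ with x∈p∪q⁻ (p - x) ⁅ x ⁆ y∈
  ... | inj₁ y∈p-x = p─q⊆p p ⁅ x ⁆ y∈p-x
  ... | inj₂ y∈⁅x⁆ rewrite x∈⁅y⁆⇒x≡y x y∈⁅x⁆ = x∈p
  p⊆ : p ⊆ (p - x) ∪ ⁅ x ⁆
  p⊆ {y} y∈p with y ≟ᶠ x
  ... | yes refl = x∈p∪q⁺ (inj₂ (x∈⁅x⁆ x))
  ... | no y≢x   = x∈p∪q⁺ (inj₁ (x∈p∧x≢y⇒x∈p-y y∈p y≢x))

module _ {n : ℕ} where

  PureOfSize : Complex n → ℕ → Set
  PureOfSize Δ d = ∀ σ → Facet Δ σ → ∣ σ ∣ ≡ d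

  PureVD : Complex n → ℕ → Set₁
  PureVD Δ d = VertexDecomposable Δ × PureOfSize Δ d

  PureOfSize⇒Pure : ∀ {Δ d} → PureOfSize Δ d → Pure Δ
  PureOfSize⇒Pure size σ τ σ-facet τ-facet = trans (size σ σ-facet) (sym (size τ τ-facet))

  module _ {Δ Δ′ : Complex n} (Δ≐Δ′ : Δ ≐ Δ′) where

    private
      Δ⊆Δ′ = proj₁ Δ≐Δ′
      Δ′⊆Δ = proj₂ Δ≐Δ′

    Facet-resp-≐ : ∀ {σ} → Facet Δ σ → Facet Δ′ σ
    Facet-resp-≐ (σ∈Δ , maximal) = Δ⊆Δ′ σ∈Δ , λ τ τ∈Δ′ → maximal τ (Δ′⊆Δ τ∈Δ′)

    IsSimplex-resp-≐ : IsSimplex Δ → IsSimplex Δ′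
    IsSimplex-resp-≐ (σ , σ∈Δ , faces) =
      σ , Δ⊆Δ′ σ∈Δ , λ τ → proj₁ (faces τ) ∘ Δ′⊆Δ , Δ⊆Δ′ ∘ proj₂ (faces τ)

    link-resp-≐ : ∀ v → link Δ v ≐ link Δ′ v
    link-resp-≐ v = map₂ Δ⊆Δ′ , map₂ Δ′⊆Δ

    deletion-resp-≐ : ∀ v → deletion Δ v ≐ deletion Δ′ v
    deletion-resp-≐ v = map₂ Δ⊆Δ′ , map₂ Δ′⊆Δ

  Pure-resp-≐ : ∀ {Δ Δ′} → Δ ≐ Δ′ → Pure Δ → Pure Δ′
  Pure-resp-≐ Δ≐Δ′ pure σ τ σ-facet τ-facet =
    pure σ τ (Facet-resp-≐ (≐-sym Δ≐Δ′) σ-facet) (Facet-resp-≐ (≐-sym Δ≐Δ′) τ-facet)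

  VertexDecomposable-resp-≐ : ∀ {Δ Δ′} → Δ ≐ Δ′ → VertexDecomposable Δ → VertexDecomposable Δ′
  VertexDecomposable-resp-≐ Δ≐Δ′ (simplex pure simp) =
    simplex (Pure-resp-≐ Δ≐Δ′ pure) (IsSimplex-resp-≐ Δ≐Δ′ simp)
  VertexDecomposable-resp-≐ Δ≐Δ′ (shed pure v v∈Δ lk del) =
    shed (Pure-resp-≐ Δ≐Δ′ pure) v (proj₁ Δ≐Δ′ v∈Δ)
         (VertexDecomposable-resp-≐ (link-resp-≐ Δ≐Δ′ v) lk)
         (VertexDecomposable-resp-≐ (deletion-resp-≐ Δ≐Δ′ v) del)

  PureVD-resp-≐ : ∀ {Δ Δ′ d} → Δ ≐ Δ′ → PureVD Δ d → PureVD Δ′ d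
  PureVD-resp-≐ Δ≐Δ′ (vd , size) =
    VertexDecomposable-resp-≐ Δ≐Δ′ vd , λ σ → size σ ∘ Facet-resp-≐ (≐-sym Δ≐Δ′)

module _ {n : ℕ} {Δ : Complex n} {v : Fin n} where

  link-facet : ∀ {σ} → v ∈ σ → Facet Δ σ → Facet (link Δ v) (σ - v)
  link-facet {σ} v∈σ (σ∈Δ , σ-maximal) =
    (x∉p-x σ v , subst Δ (sym (p-x∪⁅x⁆≡p v∈σ)) σ∈Δ) , maximal
    where
    maximal : ∀ τ → link Δ v τ → σ - v ⊆ τ → τ ≡ σ - v
    maximal τ (v∉τ , τ+v∈Δ) σ-v⊆τ = ⊆-antisym τ⊆σ-v σ-v⊆τ
      where
      σ⊆τ+v : σ ⊆ τ ∪ ⁅ v ⁆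
      σ⊆τ+v {x} x∈σ with x ≟ᶠ v
      ... | yes refl = x∈p∪q⁺ (inj₂ (x∈⁅x⁆ v))
      ... | no x≢v   = x∈p∪q⁺ (inj₁ (σ-v⊆τ (x∈p∧x≢y⇒x∈p-y x∈σ x≢v)))
      τ⊆σ-v : τ ⊆ σ - v
      τ⊆σ-v {x} x∈τ = x∈p∧x≢y⇒x∈p-y
        (subst (x ∈_) (σ-maximal _ τ+v∈Δ σ⊆τ+v) (p⊆p∪q ⁅ v ⁆ x∈τ)) λ { refl → v∉τ x∈τ }

  deletion-facet : ∀ {σ} → v ∉ σ → Facet Δ σ → Facet (deletion Δ v) σ
  deletion-facet v∉σ (σ∈Δ , σ-maximal) = (v∉σ , σ∈Δ) , λ τ τ∈ → σ-maximal τ (proj₂ τ∈)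

  facet-∋-cone-point : (∀ {σ} → Δ σ → Δ (σ ∪ ⁅ v ⁆)) → ∀ {σ} → Facet Δ σ → v ∈ σ
  facet-∋-cone-point cone (σ∈Δ , σ-maximal) =
    subst (v ∈_) (σ-maximal _ (cone σ∈Δ) (p⊆p∪q ⁅ v ⁆)) (x∈p∪q⁺ (inj₂ (x∈⁅x⁆ v)))

  shedding : ∀ {d} → Δ ⁅ v ⁆ → PureVD (link Δ v) d → VertexDecomposable (deletion Δ v) →
             (∀ σ → Facet Δ σ → v ∉ σ → ∣ σ ∣ ≡ suc d) → PureVD Δ (suc d)
  shedding {d} v∈Δ (link-vd , link-size) deletion-vd avoiding-size =
    shed (PureOfSize⇒Pure size) v v∈Δ link-vd deletion-vd , size
    where
    size : PureOfSize Δ (suc d)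
    size σ σ-facet with v ∈? σ
    ... | yes v∈σ = trans (∣p∣≡1+∣p-x∣ v∈σ) (cong suc (link-size (σ - v) (link-facet v∈σ σ-facet)))
    ... | no v∉σ  = avoiding-size σ σ-facet v∉σ

  shedding-vertex : ∀ {d} → Δ ⁅ v ⁆ → PureVD (link Δ v) d → PureVD (deletion Δ v) (suc d) →
                    PureVD Δ (suc d)
  shedding-vertex v∈Δ lk (deletion-vd , deletion-size) =
    shedding v∈Δ lk deletion-vd λ σ σ-facet v∉σ → deletion-size σ (deletion-facet v∉σ σ-facet)

  cone-vertex : ∀ {d} → Δ ⁅ v ⁆ → (∀ {σ} → Δ σ → Δ (σ ∪ ⁅ v ⁆)) →
                PureVD (link Δ v) d → VertexDecomposable (deletion Δ v) → PureVD Δ (suc d)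
  cone-vertex v∈Δ cone lk deletion-vd =
    shedding v∈Δ lk deletion-vd λ σ σ-facet v∉σ → ⊥-elim (v∉σ (facet-∋-cone-point cone σ-facet))

module IndependenceComplex {n : ℕ} (E : Fin n → Fin n → Set)
  (E-sym : ∀ {u v} → E u v → E v u) (E-irrefl : ∀ {u} → ¬ E u u) where

  IndOn : Pred (Fin n) 0ℓ → Complex n
  IndOn V σ = (∀ {u} → u ∈ σ → V u) × Ind E σ

  N[_] : Fin n → Pred (Fin n) 0ℓ
  N[ v ] u = v ≡ u ⊎ E v u

  IndOn-resp-≐ : ∀ {V W} → V ≐ W → IndOn V ≐ IndOn W
  IndOn-resp-≐ (V⊆W , W⊆V) = map₁ (V⊆W ∘_) , map₁ (W⊆V ∘_)

  Ind≐IndOn : ∀ {V} → Universal V → Ind E ≐ IndOn V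
  Ind≐IndOn all = (λ ind → (λ {u} _ → all u) , ind) , proj₂

  Ind-∪⁅⁆ : ∀ {σ v} → Ind E σ → (∀ {u} → u ∈ σ → ¬ E v u) → Ind E (σ ∪ ⁅ v ⁆)
  Ind-∪⁅⁆ {σ} {v} ind v-indep u w u∈ w∈ with x∈p∪q⁻ σ ⁅ v ⁆ u∈ | x∈p∪q⁻ σ ⁅ v ⁆ w∈
  ... | inj₁ u∈σ | inj₁ w∈σ = ind u w u∈σ w∈σ
  ... | inj₁ u∈σ | inj₂ w∈v rewrite x∈⁅y⁆⇒x≡y v w∈v = v-indep u∈σ ∘ E-sym
  ... | inj₂ u∈v | inj₁ w∈σ rewrite x∈⁅y⁆⇒x≡y v u∈v = v-indep w∈σ
  ... | inj₂ u∈v | inj₂ w∈v rewrite x∈⁅y⁆⇒x≡y v u∈v | x∈⁅y⁆⇒x≡y v w∈v = E-irrefl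

  module _ {V : Pred (Fin n) 0ℓ} where

    IndOn-∪⁅⁆ : ∀ {σ v} → IndOn V σ → V v → (∀ {u} → u ∈ σ → ¬ E v u) → IndOn V (σ ∪ ⁅ v ⁆)
    IndOn-∪⁅⁆ {σ} {v} (σ⊆V , ind) Vv v-indep = ⊆V , Ind-∪⁅⁆ ind v-indep
      where
      ⊆V : ∀ {u} → u ∈ σ ∪ ⁅ v ⁆ → V u
      ⊆V u∈ with x∈p∪q⁻ σ ⁅ v ⁆ u∈
      ... | inj₁ u∈σ = σ⊆V u∈σ
      ... | inj₂ u∈v rewrite x∈⁅y⁆⇒x≡y v u∈v = Vv

    IndOn-⁅⁆ : ∀ {v} → V v → IndOn V ⁅ v ⁆
    IndOn-⁅⁆ {v} Vv = (λ u∈ → subst V (sym (x∈⁅y⁆⇒x≡y v u∈)) Vv) , ind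
      where
      ind : Ind E ⁅ v ⁆
      ind u w u∈ w∈ rewrite x∈⁅y⁆⇒x≡y v u∈ | x∈⁅y⁆⇒x≡y v w∈ = E-irrefl

    link-IndOn : ∀ {v} → V v → link (IndOn V) v ≐ IndOn (V ∩ ∁ N[ v ])
    link-IndOn {v} Vv = to , from
      where
      to : ∀ {τ} → link (IndOn V) v τ → IndOn (V ∩ ∁ N[ v ]) τ
      to {τ} (v∉τ , τ+v⊆V , ind) = τ⊆ , λ u w u∈ w∈ → ind u w (p⊆p∪q ⁅ v ⁆ u∈) (p⊆p∪q ⁅ v ⁆ w∈)
        where
        τ⊆ : ∀ {u} → u ∈ τ → (V ∩ ∁ N[ v ]) u
        τ⊆ u∈τ = τ+v⊆V (p⊆p∪q ⁅ v ⁆ u∈τ) , λ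
          { (inj₁ refl) → v∉τ u∈τ
          ; (inj₂ vu)   → ind _ _ (x∈p∪q⁺ (inj₂ (x∈⁅x⁆ v))) (p⊆p∪q ⁅ v ⁆ u∈τ) vu }
      from : ∀ {τ} → IndOn (V ∩ ∁ N[ v ]) τ → link (IndOn V) v τ
      from (τ⊆ , ind) =
        (λ v∈τ → proj₂ (τ⊆ v∈τ) (inj₁ refl)) ,
        IndOn-∪⁅⁆ (proj₁ ∘ τ⊆ , ind) Vv (λ u∈τ → proj₂ (τ⊆ u∈τ) ∘ inj₂)

    deletion-IndOn : ∀ {v} → deletion (IndOn V) v ≐ IndOn (V ∩ ∁ ｛ v ｝)
    deletion-IndOn {v} =
      (λ { (v∉τ , τ⊆V , ind) → (λ u∈τ → τ⊆V u∈τ , λ { refl → v∉τ u∈τ }) , ind }) ,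
      (λ { (τ⊆ , ind) → (λ v∈τ → proj₂ (τ⊆ v∈τ) refl) , proj₁ ∘ τ⊆ , ind })

    IndOn-empty : Empty V → PureVD (IndOn V) 0
    IndOn-empty ∅ =
      simplex (PureOfSize⇒Pure size) (⊥ , ⊆⊥⇒face id , λ τ → face⇒⊆⊥ , ⊆⊥⇒face) , size
      where
      face⇒⊆⊥ : ∀ {τ} → IndOn V τ → τ ⊆ ⊥
      face⇒⊆⊥ (τ⊆V , _) u∈τ = ⊥-elim (∅ _ (τ⊆V u∈τ))
      ⊆⊥⇒face : ∀ {τ} → τ ⊆ ⊥ → IndOn V τ
      ⊆⊥⇒face τ⊆⊥ = (λ u∈τ → ⊥-elim (∉⊥ (τ⊆⊥ u∈τ))) , λ u _ u∈τ → ⊥-elim (∉⊥ (τ⊆⊥ u∈τ))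
      size : PureOfSize (IndOn V) 0
      size σ (σ∈ , _) = trans (cong ∣_∣ (⊆-antisym (face⇒⊆⊥ σ∈) ⊥⊆)) (∣⊥∣≡0 n)

    IndOn-shed : ∀ {v d} → V v → PureVD (IndOn (V ∩ ∁ N[ v ])) d →
                 PureVD (IndOn (V ∩ ∁ ｛ v ｝)) (suc d) → PureVD (IndOn V) (suc d)
    IndOn-shed Vv lk del =
      shedding-vertex (IndOn-⁅⁆ Vv)
        (PureVD-resp-≐ (≐-sym (link-IndOn Vv)) lk) (PureVD-resp-≐ (≐-sym deletion-IndOn) del)

    IndOn-cone : ∀ {v d} → V v → (∀ {u} → V u → ¬ E v u) → PureVD (IndOn (V ∩ ∁ ｛ v ｝)) d →
                 PureVD (IndOn V) (suc d)
    IndOn-cone {v} Vv isolated del =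
      cone-vertex (IndOn-⁅⁆ Vv) (λ σ∈ → IndOn-∪⁅⁆ σ∈ Vv (isolated ∘ proj₁ σ∈))
        (PureVD-resp-≐ (≐-sym (≐-trans (link-IndOn Vv) (IndOn-resp-≐ closed≐open))) del)
        (proj₁ (PureVD-resp-≐ (≐-sym deletion-IndOn) del))
      where
      closed≐open : V ∩ ∁ N[ v ] ≐ V ∩ ∁ ｛ v ｝
      closed≐open = map₂ (_∘ inj₁) , λ (Vu , v≢u) → Vu , [ v≢u , isolated Vu ]

-- The labels a i, b i and c i of Defs, written so that they reduce for symbolic i
-- (3 * i ∸ 4 does not).
a′ b′ c′ : ℕ → ℕ
a′ (suc (suc i)) = 2 + i * 3
a′ _             = 0
b′ (suc (suc i)) = 3 + i * 3
b′ i             = i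
c′ (suc (suc i)) = 4 + i * 3
c′ i             = i

a′≗a : a′ ≗ a
a′≗a 0             = refl
a′≗a 1             = refl
a′≗a (suc (suc i)) = cong (_∸ 4) (*-comm (suc (suc i)) 3)

b′≗b : b′ ≗ b
b′≗b 0             = refl
b′≗b 1             = refl
b′≗b (suc (suc i)) = cong (_∸ 3) (*-comm (suc (suc i)) 3)

c′≗c : c′ ≗ c
c′≗c 0             = refl
c′≗c 1             = refl
c′≗c (suc (suc i)) = cong (_∸ 2) (*-comm (suc (suc i)) 3)

data Edge : ℕ → ℕ → Set where
  a₁b₁   : Edge (a′ 1) (b′ 1)
  a₁a₂   : Edge (a′ 1) (a′ 2)
  b₁c₂   : Edge (b′ 1) (c′ 2)
  aᵢbᵢ   : ∀ s → Edge (a′ (2 + s)) (b′ (2 + s))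
  bᵢcᵢ   : ∀ s → Edge (b′ (2 + s)) (c′ (2 + s))
  aᵢaᵢ₊₁ : ∀ s → Edge (a′ (2 + s)) (a′ (3 + s))
  bᵢcᵢ₊₁ : ∀ s → Edge (b′ (2 + s)) (c′ (3 + s))
  cᵢaᵢ₊₁ : ∀ s → Edge (c′ (2 + s)) (a′ (3 + s))

Edge-shift : ∀ {x y} → Edge (2 + x) y → Edge (5 + x) (3 + y)
Edge-shift (aᵢbᵢ s)   = aᵢbᵢ (suc s)
Edge-shift (bᵢcᵢ s)   = bᵢcᵢ (suc s)
Edge-shift (aᵢaᵢ₊₁ s) = aᵢaᵢ₊₁ (suc s)
Edge-shift (bᵢcᵢ₊₁ s) = bᵢcᵢ₊₁ (suc s)
Edge-shift (cᵢaᵢ₊₁ s) = cᵢaᵢ₊₁ (suc s)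

-- From level 2 on, the edges are invariant under adding 3 to both labels.
edge? : ℕ → ℕ → Bool
edge? 0 1 = true
edge? 0 2 = true
edge? 1 4 = true
edge? 2 3 = true
edge? 3 4 = true
edge? 2 5 = true
edge? 3 7 = true
edge? 4 5 = true
edge? (suc (suc (suc (suc (suc x))))) (suc (suc (suc y))) = edge? (suc (suc x)) y
edge? _ _ = false

Edge⇒edge? : ∀ {x y} → Edge x y → T (edge? x y)
Edge⇒edge? a₁b₁             = _
Edge⇒edge? a₁a₂             = _
Edge⇒edge? b₁c₂             = _
Edge⇒edge? (aᵢbᵢ zero)      = _
Edge⇒edge? (aᵢbᵢ (suc s))   = Edge⇒edge? (aᵢbᵢ s)
Edge⇒edge? (bᵢcᵢ zero)      = _
Edge⇒edge? (bᵢcᵢ (suc s))   = Edge⇒edge? (bᵢcᵢ s)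
Edge⇒edge? (aᵢaᵢ₊₁ zero)    = _
Edge⇒edge? (aᵢaᵢ₊₁ (suc s)) = Edge⇒edge? (aᵢaᵢ₊₁ s)
Edge⇒edge? (bᵢcᵢ₊₁ zero)    = _
Edge⇒edge? (bᵢcᵢ₊₁ (suc s)) = Edge⇒edge? (bᵢcᵢ₊₁ s)
Edge⇒edge? (cᵢaᵢ₊₁ zero)    = _
Edge⇒edge? (cᵢaᵢ₊₁ (suc s)) = Edge⇒edge? (cᵢaᵢ₊₁ s)

edge?⇒Edge : ∀ x y → T (edge? x y) → Edge x y
edge?⇒Edge 0 1 _ = a₁b₁
edge?⇒Edge 0 2 _ = a₁a₂
edge?⇒Edge 1 4 _ = b₁c₂
edge?⇒Edge 2 3 _ = aᵢbᵢ 0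
edge?⇒Edge 3 4 _ = bᵢcᵢ 0
edge?⇒Edge 2 5 _ = aᵢaᵢ₊₁ 0
edge?⇒Edge 3 7 _ = bᵢcᵢ₊₁ 0
edge?⇒Edge 4 5 _ = cᵢaᵢ₊₁ 0
edge?⇒Edge (suc (suc (suc (suc (suc x))))) (suc (suc (suc y))) e =
  Edge-shift (edge?⇒Edge (suc (suc x)) y e)

edge?-irrefl : ∀ x → ¬ T (edge? x x)
edge?-irrefl (suc (suc (suc (suc (suc x))))) = edge?-irrefl (suc (suc x))

Edge-irrefl : ∀ {x} → ¬ Edge x x
Edge-irrefl {x} = edge?-irrefl x ∘ Edge⇒edge?

edgesG-mono : ∀ {j k e} → j ≤ k → e ∈ᴸ edgesG j → e ∈ᴸ edgesG k
edgesG-mono j≤k = go (≤⇒≤′ j≤k)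
  where
  go : ∀ {j k e} → j ≤′ k → e ∈ᴸ edgesG j → e ∈ᴸ edgesG k
  go ≤′-refl        e∈ = e∈
  go (≤′-step j≤′k) e∈ = ∈-++⁺ˡ (go j≤′k e∈)

level≤ : ∀ {i k y} → 2 + i * 3 ≤ y → y < nG k → suc i ≤ k
level≤ {i} {k} {y} i≤y y<n = ≤-pred (*-cancelʳ-< 3 (suc i) (suc k) (begin-strict
  suc i * 3   ≤⟨ s≤s i≤y ⟩
  suc y       ≤⟨ y<n ⟩
  2 + 3 * k   ≡⟨ cong (2 +_) (*-comm 3 k) ⟩
  2 + k * 3   <⟨ n<1+n _ ⟩
  suc k * 3   ∎))
  where open ≤-Reasoning

added∈edgesG : ∀ {i x y} k → (x , y) ∈ᴸ newEdges (suc i) ++ extraEdge (suc i) →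
               2 + i * 3 ≤ y → y < nG k → (x , y) ∈ᴸ edgesG k
added∈edgesG {i} k e∈ i≤y y<n = edgesG-mono {k = k} (level≤ i≤y y<n) (∈-++⁺ʳ (edgesG i) e∈)

Edge⇒∈edgesG : ∀ {x y} k → Edge x y → y < nG k → (x , y) ∈ᴸ edgesG k
Edge⇒∈edgesG k a₁b₁ _ = edgesG-mono {k = k} z≤n (here refl)
Edge⇒∈edgesG k a₁a₂ = added∈edgesG {0} k (here refl) (s≤s (s≤s z≤n))
Edge⇒∈edgesG k b₁c₂ = added∈edgesG {0} k (there (here refl)) (s≤s (s≤s z≤n))
Edge⇒∈edgesG k (aᵢbᵢ s) = added∈edgesG {s} k
  (there (there (here (cong₂ _,_ (a′≗a (2 + s)) (b′≗b (2 + s))))))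
  (n≤1+n _)
Edge⇒∈edgesG k (bᵢcᵢ s) = added∈edgesG {s} k
  (there (there (there (here (cong₂ _,_ (b′≗b (2 + s)) (c′≗c (2 + s)))))))
  (≤-trans (n≤1+n _) (n≤1+n _))
Edge⇒∈edgesG k (aᵢaᵢ₊₁ s) = added∈edgesG {suc s} k
  (here (cong₂ _,_ (a′≗a (2 + s)) (a′≗a (3 + s))))
  ≤-refl
Edge⇒∈edgesG k (bᵢcᵢ₊₁ s) = added∈edgesG {suc s} k
  (there (here (cong₂ _,_ (b′≗b (2 + s)) (c′≗c (3 + s)))))
  (≤-trans (n≤1+n _) (n≤1+n _))
Edge⇒∈edgesG k (cᵢaᵢ₊₁ s) = added∈edgesG {suc s} k
  (∈-++⁺ʳ (newEdges (2 + s)) (here (cong₂ _,_ (c′≗c (2 + s)) (a′≗a (3 + s)))))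
  ≤-refl

∈added⇒Edge : ∀ i {x y} → (x , y) ∈ᴸ newEdges (suc i) ++ extraEdge (suc i) → Edge x y
∈added⇒Edge zero    (here refl)                         = a₁a₂
∈added⇒Edge zero    (there (here refl))                 = b₁c₂
∈added⇒Edge zero    (there (there (here refl)))         = aᵢbᵢ 0
∈added⇒Edge zero    (there (there (there (here refl)))) = bᵢcᵢ 0
∈added⇒Edge (suc s) (here refl) =
  subst₂ Edge (a′≗a (2 + s)) (a′≗a (3 + s)) (aᵢaᵢ₊₁ s)
∈added⇒Edge (suc s) (there (here refl)) =
  subst₂ Edge (b′≗b (2 + s)) (c′≗c (3 + s)) (bᵢcᵢ₊₁ s)
∈added⇒Edge (suc s) (there (there (here refl))) =
  subst₂ Edge (a′≗a (3 + s)) (b′≗b (3 + s)) (aᵢbᵢ (suc s))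
∈added⇒Edge (suc s) (there (there (there (here refl)))) =
  subst₂ Edge (b′≗b (3 + s)) (c′≗c (3 + s)) (bᵢcᵢ (suc s))
∈added⇒Edge (suc s) (there (there (there (there (here refl))))) =
  subst₂ Edge (c′≗c (2 + s)) (a′≗a (3 + s)) (cᵢaᵢ₊₁ s)

∈edgesG⇒Edge : ∀ k {x y} → (x , y) ∈ᴸ edgesG k → Edge x y
∈edgesG⇒Edge zero    (here refl) = a₁b₁
∈edgesG⇒Edge (suc k) e∈ with ∈-++⁻ (edgesG k) e∈
... | inj₁ e∈old   = ∈edgesG⇒Edge k e∈old
... | inj₂ e∈added = ∈added⇒Edge k e∈added

adj? : ℕ → ℕ → Bool
adj? x y = edge? x y ∨ edge? y x

LabelSet : Set
LabelSet = ℕ → Bool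

infixl 6 _∖｛_｝ _∖N[_] _∪｛_｝

_∖｛_｝ : LabelSet → ℕ → LabelSet
(P ∖｛ x ｝) y = P y ∧ not (y ≡ᵇ x)

_∖N[_] : LabelSet → ℕ → LabelSet
(P ∖N[ x ]) y = P y ∧ not ((y ≡ᵇ x) ∨ adj? x y)

_∪｛_｝ : LabelSet → ℕ → LabelSet
(P ∪｛ x ｝) y = P y ∨ (y ≡ᵇ x)

G : ℕ → LabelSet
G zero    _ = false
G (suc i) y = y <ᵇ 2 + i * 3

-- The implicit argument reduces to ⊤ exactly when P and Q agree on the labels below B,
-- so those are checked by evaluation; above B the caller supplies the agreement.
≗-byEvaluation : ∀ B {P Q : LabelSet} → (∀ z → P (B + z) ≡ Q (B + z)) →
                 {True (all? λ (y : Fin B) → P (toℕ y) ≟ᵇ Q (toℕ y))} → P ≗ Q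
≗-byEvaluation B {P} {Q} above {below} y with y <? B
... | yes y<B = subst (λ w → P w ≡ Q w) (toℕ-fromℕ< y<B) (toWitness below (fromℕ< y<B))
... | no y≮B  = let z , B+z≡y = m≤n⇒∃[o]m+o≡n (≮⇒≥ y≮B) in subst (λ w → P w ≡ Q w) B+z≡y (above z)

G₁∖N[a₁]≗G₀ : G 1 ∖N[ a′ 1 ] ≗ G 0
G₁∖N[a₁]≗G₀ = ≗-byEvaluation 5 λ _ → refl

G₁∖a₁≗G₀∪b₁ : G 1 ∖｛ a′ 1 ｝ ≗ G 0 ∪｛ b′ 1 ｝
G₁∖a₁≗G₀∪b₁ = ≗-byEvaluation 5 λ _ → refl

G₁∖b₁≗G₀∪a₁ : G 1 ∖｛ b′ 1 ｝ ≗ G 0 ∪｛ a′ 1 ｝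
G₁∖b₁≗G₀∪a₁ = ≗-byEvaluation 5 λ _ → refl

-- For n ≥ 3 both sides at label 5 + y reduce to the instance at n - 1 and label 2 + y:
-- above level 2, G_{n+1} is G_n translated by three labels.
G∖N[a]∖N[b]≗G : ∀ n → G (2 + n) ∖N[ a′ (2 + n) ] ∖N[ b′ (1 + n) ] ≗ G n
G∖N[a]∖N[b]≗G 0 = ≗-byEvaluation 8 λ _ → refl
G∖N[a]∖N[b]≗G 1 = ≗-byEvaluation 11 λ _ → refl
G∖N[a]∖N[b]≗G 2 = ≗-byEvaluation 14 λ _ → refl
G∖N[a]∖N[b]≗G (suc (suc (suc n))) = ≗-byEvaluation 5 λ y → G∖N[a]∖N[b]≗G (suc (suc n)) (2 + y)

G∖N[a]∖b≗G∪c : ∀ n → G (2 + n) ∖N[ a′ (2 + n) ] ∖｛ b′ (1 + n) ｝ ≗ G n ∪｛ c′ (2 + n) ｝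
G∖N[a]∖b≗G∪c 0 = ≗-byEvaluation 8 λ _ → refl
G∖N[a]∖b≗G∪c 1 = ≗-byEvaluation 11 λ _ → refl
G∖N[a]∖b≗G∪c 2 = ≗-byEvaluation 14 λ _ → refl
G∖N[a]∖b≗G∪c (suc (suc (suc n))) = ≗-byEvaluation 5 λ y → G∖N[a]∖b≗G∪c (suc (suc n)) (2 + y)

G∖N[c]≗G : ∀ n → G n ∖N[ c′ (2 + n) ] ≗ G n
G∖N[c]≗G 0 = ≗-byEvaluation 8 λ _ → refl
G∖N[c]≗G 1 = ≗-byEvaluation 11 λ _ → refl
G∖N[c]≗G 2 = ≗-byEvaluation 14 λ _ → refl
G∖N[c]≗G (suc (suc (suc n))) = ≗-byEvaluation 5 λ y → G∖N[c]≗G (suc (suc n)) (2 + y)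

G∖a∖N[c]≗G∖b : ∀ n → G (2 + n) ∖｛ a′ (2 + n) ｝ ∖N[ c′ (2 + n) ] ≗ G (1 + n) ∖｛ b′ (1 + n) ｝
G∖a∖N[c]≗G∖b 0 = ≗-byEvaluation 8 λ _ → refl
G∖a∖N[c]≗G∖b 1 = ≗-byEvaluation 11 λ _ → refl
G∖a∖N[c]≗G∖b 2 = ≗-byEvaluation 14 λ _ → refl
G∖a∖N[c]≗G∖b (suc (suc (suc n))) = ≗-byEvaluation 5 λ y → G∖a∖N[c]≗G∖b (suc (suc n)) (2 + y)

G∖a∖c≗G∪b : ∀ n → G (2 + n) ∖｛ a′ (2 + n) ｝ ∖｛ c′ (2 + n) ｝ ≗ G (1 + n) ∪｛ b′ (2 + n) ｝
G∖a∖c≗G∪b 0 = ≗-byEvaluation 8 λ _ → refl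
G∖a∖c≗G∪b 1 = ≗-byEvaluation 11 λ _ → refl
G∖a∖c≗G∪b 2 = ≗-byEvaluation 14 λ _ → refl
G∖a∖c≗G∪b (suc (suc (suc n))) = ≗-byEvaluation 5 λ y → G∖a∖c≗G∪b (suc (suc n)) (2 + y)

G∖N[b]≗G : ∀ n → G (1 + n) ∖N[ b′ (2 + n) ] ≗ G (1 + n)
G∖N[b]≗G 0 = ≗-byEvaluation 8 λ _ → refl
G∖N[b]≗G 1 = ≗-byEvaluation 11 λ _ → refl
G∖N[b]≗G 2 = ≗-byEvaluation 14 λ _ → refl
G∖N[b]≗G (suc (suc (suc n))) = ≗-byEvaluation 5 λ y → G∖N[b]≗G (suc (suc n)) (2 + y)

G∖b∖N[b]≗G∪a : ∀ n → G (2 + n) ∖｛ b′ (2 + n) ｝ ∖N[ b′ (1 + n) ] ≗ G n ∪｛ a′ (2 + n) ｝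
G∖b∖N[b]≗G∪a 0 = ≗-byEvaluation 8 λ _ → refl
G∖b∖N[b]≗G∪a 1 = ≗-byEvaluation 11 λ _ → refl
G∖b∖N[b]≗G∪a 2 = ≗-byEvaluation 14 λ _ → refl
G∖b∖N[b]≗G∪a (suc (suc (suc n))) = ≗-byEvaluation 5 λ y → G∖b∖N[b]≗G∪a (suc (suc n)) (2 + y)

G∖b∖b≗G∖b∪a∪c : ∀ n → G (2 + n) ∖｛ b′ (2 + n) ｝ ∖｛ b′ (1 + n) ｝
                   ≗ G (1 + n) ∖｛ b′ (1 + n) ｝ ∪｛ a′ (2 + n) ｝ ∪｛ c′ (2 + n) ｝
G∖b∖b≗G∖b∪a∪c 0 = ≗-byEvaluation 8 λ _ → refl
G∖b∖b≗G∖b∪a∪c 1 = ≗-byEvaluation 11 λ _ → refl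
G∖b∖b≗G∖b∪a∪c 2 = ≗-byEvaluation 14 λ _ → refl
G∖b∖b≗G∖b∪a∪c (suc (suc (suc n))) = ≗-byEvaluation 5 λ y → G∖b∖b≗G∖b∪a∪c (suc (suc n)) (2 + y)

G∖N[a]≗G : ∀ n → G n ∖N[ a′ (2 + n) ] ≗ G n
G∖N[a]≗G 0 = ≗-byEvaluation 8 λ _ → refl
G∖N[a]≗G 1 = ≗-byEvaluation 11 λ _ → refl
G∖N[a]≗G 2 = ≗-byEvaluation 14 λ _ → refl
G∖N[a]≗G (suc (suc (suc n))) = ≗-byEvaluation 5 λ y → G∖N[a]≗G (suc (suc n)) (2 + y)

G∖b∪a∖N[c]≗G∖b∪a : ∀ n → G (1 + n) ∖｛ b′ (1 + n) ｝ ∪｛ a′ (2 + n) ｝ ∖N[ c′ (2 + n) ]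
                      ≗ G (1 + n) ∖｛ b′ (1 + n) ｝ ∪｛ a′ (2 + n) ｝
G∖b∪a∖N[c]≗G∖b∪a 0 = ≗-byEvaluation 8 λ _ → refl
G∖b∪a∖N[c]≗G∖b∪a 1 = ≗-byEvaluation 11 λ _ → refl
G∖b∪a∖N[c]≗G∖b∪a 2 = ≗-byEvaluation 14 λ _ → refl
G∖b∪a∖N[c]≗G∖b∪a (suc (suc (suc n))) = ≗-byEvaluation 5 λ y → G∖b∪a∖N[c]≗G∖b∪a (suc (suc n)) (2 + y)

G∖b∪a∖N[a]≗G : ∀ n → G (1 + n) ∖｛ b′ (1 + n) ｝ ∪｛ a′ (2 + n) ｝ ∖N[ a′ (2 + n) ] ≗ G n
G∖b∪a∖N[a]≗G 0 = ≗-byEvaluation 8 λ _ → refl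
G∖b∪a∖N[a]≗G 1 = ≗-byEvaluation 11 λ _ → refl
G∖b∪a∖N[a]≗G 2 = ≗-byEvaluation 14 λ _ → refl
G∖b∪a∖N[a]≗G (suc (suc (suc n))) = ≗-byEvaluation 5 λ y → G∖b∪a∖N[a]≗G (suc (suc n)) (2 + y)

G∖b∪a∖a≗G∖b : ∀ n → G (1 + n) ∖｛ b′ (1 + n) ｝ ∪｛ a′ (2 + n) ｝ ∖｛ a′ (2 + n) ｝
                 ≗ G (1 + n) ∖｛ b′ (1 + n) ｝
G∖b∪a∖a≗G∖b 0 = ≗-byEvaluation 8 λ _ → refl
G∖b∪a∖a≗G∖b 1 = ≗-byEvaluation 11 λ _ → refl
G∖b∪a∖a≗G∖b 2 = ≗-byEvaluation 14 λ _ → refl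
G∖b∪a∖a≗G∖b (suc (suc (suc n))) = ≗-byEvaluation 5 λ y → G∖b∪a∖a≗G∖b (suc (suc n)) (2 + y)

T-∧-not : ∀ {p q} → T (p ∧ not q) ⇔ (T p × ¬ T q)
T-∧-not {true}  {true}  = mk⇔ (λ ()) (λ (_ , ¬q) → ¬q _)
T-∧-not {true}  {false} = mk⇔ (λ _ → _ , λ ()) (λ _ → _)
T-∧-not {false}         = mk⇔ (λ ()) proj₁

module Labelled (k : ℕ) where

  open Equivalence

  AdjG⇒adj? : ∀ {u v} → AdjG k u v → T (adj? (toℕ u) (toℕ v))
  AdjG⇒adj? = from T-∨ ∘ ⊎-map (Edge⇒edge? ∘ ∈edgesG⇒Edge k) (Edge⇒edge? ∘ ∈edgesG⇒Edge k)

  adj?⇒AdjG : ∀ {u v} → T (adj? (toℕ u) (toℕ v)) → AdjG k u v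
  adj?⇒AdjG {u} {v} = ⊎-map (λ e → Edge⇒∈edgesG k (edge?⇒Edge _ _ e) (toℕ<n v))
                            (λ e → Edge⇒∈edgesG k (edge?⇒Edge _ _ e) (toℕ<n u)) ∘ to T-∨

  AdjG-irrefl : ∀ {u} → ¬ AdjG k u u
  AdjG-irrefl = [ Edge-irrefl ∘ ∈edgesG⇒Edge k , Edge-irrefl ∘ ∈edgesG⇒Edge k ]

  open IndependenceComplex (AdjG k) swap AdjG-irrefl public

  ⟦_⟧ : LabelSet → Pred (Fin (nG k)) 0ℓ
  ⟦ P ⟧ u = T (P (toℕ u))

  ⟦⟧-resp-≗ : ∀ {P Q} → P ≗ Q → ⟦ P ⟧ ≐ ⟦ Q ⟧
  ⟦⟧-resp-≗ P≗Q = (λ {u} → subst T (P≗Q (toℕ u))) , (λ {u} → subst T (sym (P≗Q (toℕ u))))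

  ⟦G⟧-universal : Universal ⟦ G (suc k) ⟧
  ⟦G⟧-universal u = <⇒<ᵇ (subst (toℕ u <_) (cong (2 +_) (*-comm 3 k)) (toℕ<n u))

  toℕ-≡ᵇ⇒≡ : ∀ {u v : Fin (nG k)} → T (toℕ u ≡ᵇ toℕ v) → v ≡ u
  toℕ-≡ᵇ⇒≡ {u} {v} = sym ∘ toℕ-injective ∘ ≡ᵇ⇒≡ (toℕ u) (toℕ v)

  ≡⇒toℕ-≡ᵇ : ∀ {u v : Fin (nG k)} → v ≡ u → T (toℕ u ≡ᵇ toℕ v)
  ≡⇒toℕ-≡ᵇ {u} refl = ≡⇒≡ᵇ (toℕ u) (toℕ u) refl

  ⟦∖｛｝⟧ : ∀ P {v x} → toℕ v ≡ x → ⟦ P ∖｛ x ｝ ⟧ ≐ ⟦ P ⟧ ∩ ∁ ｛ v ｝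
  ⟦∖｛｝⟧ P refl = (λ u∈ → let Pu , u≢v = to T-∧-not u∈ in Pu , u≢v ∘ ≡⇒toℕ-≡ᵇ)
                , (λ (Pu , v≢u) → from T-∧-not (Pu , v≢u ∘ toℕ-≡ᵇ⇒≡))

  ⟦∖N[]⟧ : ∀ P {v x} → toℕ v ≡ x → ⟦ P ∖N[ x ] ⟧ ≐ ⟦ P ⟧ ∩ ∁ N[ v ]
  ⟦∖N[]⟧ P refl =
    (λ u∈ → let Pu , u∉N = to T-∧-not u∈ in Pu , u∉N ∘ from T-∨ ∘ ⊎-map ≡⇒toℕ-≡ᵇ AdjG⇒adj?) ,
    (λ (Pu , u∉N) → from T-∧-not (Pu , u∉N ∘ ⊎-map toℕ-≡ᵇ⇒≡ adj?⇒AdjG ∘ to T-∨))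

  ⟦∖｛｝⟧-absent : ∀ P {x} → (∀ {u} → ⟦ P ⟧ u → toℕ u ≢ x) → ⟦ P ∖｛ x ｝ ⟧ ≐ ⟦ P ⟧
  ⟦∖｛｝⟧-absent P {x} absent =
    proj₁ ∘ to T-∧-not , λ Pu → from T-∧-not (Pu , absent Pu ∘ ≡ᵇ⇒≡ _ x)

  record IndVD (P : LabelSet) (d : ℕ) : Set₁ where
    constructor mkIndVD
    field pureVD : PureVD (IndOn ⟦ P ⟧) d

  open IndVD public

  IndVD-resp-≗ : ∀ {P Q d} → P ≗ Q → IndVD P d → IndVD Q d
  IndVD-resp-≗ P≗Q (mkIndVD vd) = mkIndVD (PureVD-resp-≐ (IndOn-resp-≐ (⟦⟧-resp-≗ P≗Q)) vd)

  -- No vertex of P needs to carry the label x: if none does, the deletion is P itself.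
  IndVD-shed : ∀ {P d} x → IndVD (P ∖N[ x ]) d → IndVD (P ∖｛ x ｝) (suc d) → IndVD P (suc d)
  IndVD-shed {P} x (mkIndVD lk) (mkIndVD del) with any? (λ u → (toℕ u ≟ x) ×-dec T? (P (toℕ u)))
  ... | yes (v , v↦x , Pv) =
    mkIndVD (IndOn-shed Pv (PureVD-resp-≐ (IndOn-resp-≐ (⟦∖N[]⟧ P v↦x)) lk)
                           (PureVD-resp-≐ (IndOn-resp-≐ (⟦∖｛｝⟧ P v↦x)) del))
  ... | no ∄v =
    mkIndVD (PureVD-resp-≐ (IndOn-resp-≐ (⟦∖｛｝⟧-absent P λ Pu u↦x → ∄v (_ , u↦x , Pu))) del)

  shedAt : ∀ {P Q₁ Q₂ d} x → P ∖N[ x ] ≗ Q₁ → P ∖｛ x ｝ ≗ Q₂ → IndVD Q₁ d → IndVD Q₂ (suc d) →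
           IndVD P (suc d)
  shedAt x link≗ deletion≗ lk del =
    IndVD-shed x (IndVD-resp-≗ (sym ∘ link≗) lk) (IndVD-resp-≗ (sym ∘ deletion≗) del)

  coneAt : ∀ {Q d} x → x < nG k → Q ∖N[ x ] ≗ Q → IndVD Q d → IndVD (Q ∪｛ x ｝) (suc d)
  coneAt x x<N with fromℕ< x<N | toℕ-fromℕ< x<N
  ... | v | refl = cone-at
    where
    cone-at : ∀ {Q d} → Q ∖N[ toℕ v ] ≗ Q → IndVD Q d → IndVD (Q ∪｛ toℕ v ｝) (suc d)
    cone-at {Q} isolated (mkIndVD vd) =
      mkIndVD (IndOn-cone (from T-∨ (inj₂ (≡⇒toℕ-≡ᵇ {v} refl))) no-neighbour
                          (PureVD-resp-≐ (IndOn-resp-≐ (≐-sym rest)) vd))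
      where
      ∉N : ∀ {u} → ⟦ Q ⟧ u → ¬ N[ v ] u
      ∉N {u} Qu = proj₂ (proj₁ (⟦∖N[]⟧ Q refl) (subst T (sym (isolated (toℕ u))) Qu))
      no-neighbour : ∀ {u} → ⟦ Q ∪｛ toℕ v ｝ ⟧ u → ¬ AdjG k v u
      no-neighbour u∈ with to T-∨ u∈
      ... | inj₁ Qu  = ∉N Qu ∘ inj₂
      ... | inj₂ u≡v = AdjG-irrefl ∘ subst (AdjG k v) (sym (toℕ-≡ᵇ⇒≡ u≡v))
      rest : ⟦ Q ∪｛ toℕ v ｝ ⟧ ∩ ∁ ｛ v ｝ ≐ ⟦ Q ⟧
      rest = (λ (u∈ , v≢u) → [ id , ⊥-elim ∘ v≢u ∘ toℕ-≡ᵇ⇒≡ ] (to T-∨ u∈))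
           , (λ Qu → from T-∨ (inj₁ Qu) , ∉N Qu ∘ inj₁)

module Decomposition (k : ℕ) where

  open Labelled k public

  c′<nG : ∀ {n} → n < k → c′ (2 + n) < nG k
  c′<nG {n} n<k = begin-strict
    4 + n * 3       <⟨ n<1+n _ ⟩
    2 + suc n * 3   ≤⟨ +-monoʳ-≤ 2 (*-monoˡ-≤ 3 n<k) ⟩
    2 + k * 3       ≡⟨ cong (2 +_) (*-comm k 3) ⟩
    nG k            ∎
    where open ≤-Reasoning

  b′<nG : ∀ {n} → n < k → b′ (2 + n) < nG k
  b′<nG n<k = ≤-<-trans (n≤1+n _) (c′<nG n<k)

  a′<nG : ∀ {n} → n < k → a′ (2 + n) < nG k
  a′<nG n<k = ≤-<-trans (n≤1+n _) (b′<nG n<k)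

  IndVD-G      : ∀ m → m ≤ suc k → IndVD (G m) m
  IndVD-G∖N[a] : ∀ m → m ≤ k → IndVD (G (suc m) ∖N[ a′ (suc m) ]) m
  IndVD-G∖a    : ∀ m → m ≤ k → IndVD (G (suc m) ∖｛ a′ (suc m) ｝) (suc m)
  IndVD-G∖b    : ∀ m → m ≤ k → IndVD (G (suc m) ∖｛ b′ (suc m) ｝) (suc m)
  IndVD-G∖b∪a  : ∀ n → n < k → IndVD (G (suc n) ∖｛ b′ (suc n) ｝ ∪｛ a′ (2 + n) ｝) (suc n)

  IndVD-G zero    _       = mkIndVD (IndOn-empty λ _ ())
  IndVD-G (suc m) m<1+k =
    IndVD-shed (a′ (suc m)) (IndVD-G∖N[a] m (≤-pred m<1+k)) (IndVD-G∖a m (≤-pred m<1+k))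

  IndVD-G∖N[a] zero    _   = IndVD-resp-≗ (sym ∘ G₁∖N[a₁]≗G₀) (IndVD-G 0 z≤n)
  IndVD-G∖N[a] (suc n) n<k =
    shedAt (b′ (1 + n)) (G∖N[a]∖N[b]≗G n) (G∖N[a]∖b≗G∪c n)
      (IndVD-G n (m≤n⇒m≤1+n (<⇒≤ n<k)))
      (coneAt (c′ (2 + n)) (c′<nG n<k) (G∖N[c]≗G n) (IndVD-G n (m≤n⇒m≤1+n (<⇒≤ n<k))))

  IndVD-G∖a zero    _   =
    IndVD-resp-≗ (sym ∘ G₁∖a₁≗G₀∪b₁) (coneAt (b′ 1) (s≤s (s≤s z≤n)) (λ _ → refl) (IndVD-G 0 z≤n))
  IndVD-G∖a (suc n) n<k =
    shedAt (c′ (2 + n)) (G∖a∖N[c]≗G∖b n) (G∖a∖c≗G∪b n)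
      (IndVD-G∖b n (<⇒≤ n<k))
      (coneAt (b′ (2 + n)) (b′<nG n<k) (G∖N[b]≗G n) (IndVD-G (suc n) (m≤n⇒m≤1+n n<k)))

  IndVD-G∖b zero    _   =
    IndVD-resp-≗ (sym ∘ G₁∖b₁≗G₀∪a₁) (coneAt (a′ 1) (s≤s z≤n) (λ _ → refl) (IndVD-G 0 z≤n))
  IndVD-G∖b (suc n) n<k =
    shedAt (b′ (1 + n)) (G∖b∖N[b]≗G∪a n) (G∖b∖b≗G∖b∪a∪c n)
      (coneAt (a′ (2 + n)) (a′<nG n<k) (G∖N[a]≗G n) (IndVD-G n (m≤n⇒m≤1+n (<⇒≤ n<k))))
      (coneAt (c′ (2 + n)) (c′<nG n<k) (G∖b∪a∖N[c]≗G∖b∪a n) (IndVD-G∖b∪a n n<k))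

  IndVD-G∖b∪a n n<k =
    shedAt (a′ (2 + n)) (G∖b∪a∖N[a]≗G n) (G∖b∪a∖a≗G∖b n)
      (IndVD-G n (m≤n⇒m≤1+n (<⇒≤ n<k)))
      (IndVD-G∖b n (<⇒≤ n<k))

corollary3p16 : (k : ℕ) → VertexDecomposable (Ind (AdjG k))
corollary3p16 k =
  VertexDecomposable-resp-≐ (≐-sym (Ind≐IndOn ⟦G⟧-universal))
    (proj₁ (pureVD (IndVD-G (suc k) ≤-refl)))
  where open Decomposition k
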